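{- Every query expressible in first-order logic can be maintained in $\mathrm{DynCQ}^{\neg}$.
   Context: Dynamic complexity setting. A dynamic schema is a pair $(\tau_{in},\tau_{aux})$ of disjoint finite relational schemas; $\tau=\tau_{in}\cup\tau_{aux}$. A modification is $\mathrm{ins}_S(\vec a)$ or $\mathrm{del}_S(\vec a)$ for $S\in\tau_{in}$ and a tuple $\vec a$ of the arity of $S$. An update program assigns to every $R\in\tau_{aux}$ and every $\delta\in\{\mathrm{ins}_S,\mathrm{del}_S : S\in\tau_{in}\}$ a first-order formula $\phi^R_\delta(\vec u;\vec x)$ over $\tau$ (with equality), $|\vec u|$ = arity of $S$, $|\vec x|$ = arity of $R$. A state is $(D,\mathcal I,\mathcal A)$ with finite domain $D$, a $\tau_{in}$-database $\mathcal I$ and a $\tau_{aux}$-database $\mathcal A$ over $D$. Applying $\delta(\vec a)$ to a state $\mathcal S$ gives $(D,\delta(\mathcal I),\mathcal A')$ where $R^{\mathcal A'}=\{\vec b:\mathcal S\models\phi^R_\delta(\vec a;\vec b)\}$. A dynamic program is $(P,\mathrm{Init},Q)$ with $P$ an update program, $\mathrm{Init}$ an arbitrary mapping from $\tau_{in}$-databases to $\tau_{aux}$-databases over the same domain, and $Q\in\tau_{aux}$. It maintains a query $\mathcal Q$ if for every $\tau_{in}$-database $\mathcal D$ with domain $D$ and every finite modification sequence $\alpha$, $\mathcal Q(\alpha(\mathcal D))$ equals the interpretation of $Q$ in the state obtained from $(D,\mathcal D,\mathrm{Init}(\mathcal D))$ by applying $\alpha$. $\mathrm{DynCQ}^\neg$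 is the class of queries maintained by dynamic programs all of whose update formulas are of the form $\exists\vec y\,\psi$ with $\psi$ a conjunction of literals (atoms or negated atoms). A query is expressible in first-order logic if it is defined on all input databases by a fixed first-order formula over $\tau_{in}$. -}

module Defs where

open import Data.Nat using (ℕ; zero; suc; _+_)
open import Data.Fin using (Fin; zero; suc; _≟_)
open import Data.Vec using (Vec; []; _∷_; lookup; _++_)
open import Data.Vec.Properties using (≡-dec)
open import Data.Bool using (Bool; true; false; _∧_; _∨_; not)
open import Data.Sum using (_⊎_; inj₁; inj₂; [_,_])
open import Data.Product using (Σ; _×_; _,_)
open import Data.List using (List; foldl)
open import Relation.Nullary using (yes; no)
open import Relation.Nullary.Decidable using (⌊_⌋)
open import Relation.Binary.PropositionalEquality using (_≡_; refl; subst)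

record Sig : Set₁ where
  field
    Sym : Set
    ar  : Sym → ℕ
open Sig public

record Schema : Set where
  field
    size  : ℕ
    arity : Fin size → ℕ
open Schema public

sigOf : Schema → Sig
sigOf τ = record { Sym = Fin (size τ) ; ar = arity τ }

_∪ₛ_ : Schema → Schema → Sig
τ₁ ∪ₛ τ₂ = record { Sym = Fin (size τ₁) ⊎ Fin (size τ₂) ; ar = [ arity τ₁ , arity τ₂ ] }

-- First-order formulas with equality over a relational signature,
-- with v free variables (de Bruijn: Fin v; ∃/∀ bind variable zero).

data Formula (σ : Sig) : ℕ → Set where
  atom : ∀ {v} (R : Sym σ) → Vec (Fin v) (ar σ R) → Formula σ v
  eq   : ∀ {v} → Fin v → Fin v → Formula σ v
  ¬'   : ∀ {v} → Formula σ v → Formula σ v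
  _∧'_ : ∀ {v} → Formula σ v → Formula σ v → Formula σ v
  _∨'_ : ∀ {v} → Formula σ v → Formula σ v → Formula σ v
  ∃'   : ∀ {v} → Formula σ (suc v) → Formula σ v
  ∀'   : ∀ {v} → Formula σ (suc v) → Formula σ v

Tuple : ℕ → ℕ → Set
Tuple n k = Vec (Fin n) k

Rel : ℕ → ℕ → Set
Rel n k = Tuple n k → Bool

Struct : Sig → ℕ → Set
Struct σ n = (R : Sym σ) → Rel n (ar σ R)

Database : Schema → ℕ → Set
Database τ n = Struct (sigOf τ) n

anyFin : ∀ {n} → (Fin n → Bool) → Bool
anyFin {zero}  f = false
anyFin {suc n} f = f zero ∨ anyFin (λ i → f (suc i))

allFin : ∀ {n} → (Fin n → Bool) → Bool
allFin {zero}  f = true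
allFin {suc n} f = f zero ∧ allFin (λ i → f (suc i))

⟦_⟧ : ∀ {σ n v} → Formula σ v → Struct σ n → Tuple n v → Bool
⟦ atom R xs ⟧ 𝔄 ρ = 𝔄 R (Data.Vec.map (lookup ρ) xs)
⟦ eq x y    ⟧ 𝔄 ρ = ⌊ lookup ρ x ≟ lookup ρ y ⌋
⟦ ¬' φ      ⟧ 𝔄 ρ = not (⟦ φ ⟧ 𝔄 ρ)
⟦ φ ∧' ψ    ⟧ 𝔄 ρ = ⟦ φ ⟧ 𝔄 ρ ∧ ⟦ ψ ⟧ 𝔄 ρ
⟦ φ ∨' ψ    ⟧ 𝔄 ρ = ⟦ φ ⟧ 𝔄 ρ ∨ ⟦ ψ ⟧ 𝔄 ρ
⟦ ∃' φ      ⟧ 𝔄 ρ = anyFin (λ d → ⟦ φ ⟧ 𝔄 (d ∷ ρ))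
⟦ ∀' φ      ⟧ 𝔄 ρ = allFin (λ d → ⟦ φ ⟧ 𝔄 (d ∷ ρ))

data IsAtom {σ : Sig} : ∀ {v} → Formula σ v → Set where
  atomR : ∀ {v} (R : Sym σ) (xs : Vec (Fin v) (ar σ R)) → IsAtom (atom R xs)
  atomE : ∀ {v} (x y : Fin v) → IsAtom (eq {σ} x y)

data IsLiteral {σ : Sig} : ∀ {v} → Formula σ v → Set where
  pos : ∀ {v} {φ : Formula σ v} → IsAtom φ → IsLiteral φ
  neg : ∀ {v} {φ : Formula σ v} → IsAtom φ → IsLiteral (¬' φ)

data IsConjLit {σ : Sig} : ∀ {v} → Formula σ v → Set where
  lit  : ∀ {v} {φ : Formula σ v} → IsLiteral φ → IsConjLit φ
  conj : ∀ {v} {φ ψ : Formula σ v} → IsConjLit φ → IsConjLit ψ → IsConjLit (φ ∧' ψ)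

data IsCQneg {σ : Sig} : ∀ {v} → Formula σ v → Set where
  body : ∀ {v} {φ : Formula σ v} → IsConjLit φ → IsCQneg φ
  ex   : ∀ {v} {φ : Formula σ (suc v)} → IsCQneg φ → IsCQneg (∃' φ)

data Kind : Set where
  ins del : Kind

record Modification (τin : Schema) (n : ℕ) : Set where
  constructor mod
  field
    kind  : Kind
    S     : Fin (size τin)
    tuple : Tuple n (arity τin S)

_≟ₜ_ : ∀ {n k} (a b : Tuple n k) → Bool
a ≟ₜ b = ⌊ ≡-dec _≟_ a b ⌋

applyMod : ∀ {τin n} → Modification τin n → Database τin n → Database τin n
applyMod {τin} (mod k S a) I T with S ≟ T
applyMod {τin} (mod ins S a) I .S | yes refl = λ b → I S b ∨ (b ≟ₜ a)
applyMod {τin} (mod del S a) I .S | yes refl = λ b → I S b ∧ not (b ≟ₜ a)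
applyMod {τin} (mod k S a) I T | no _ = I T

applyMods : ∀ {τin n} → List (Modification τin n) → Database τin n → Database τin n
applyMods α D = foldl (λ I δ → applyMod δ I) D α

Query : Schema → ℕ → Set
Query τin k = ∀ {n} → Database τin n → Rel n k

FOExpressible : ∀ {τin k} → Query τin k → Set
FOExpressible {τin} {k} 𝒬 =
  Σ (Formula (sigOf τin) k) λ φ → ∀ {n} (D : Database τin n) (b : Tuple n k) → 𝒬 D b ≡ ⟦ φ ⟧ D b

-- φ^R_δ(ū; x̄): free variables ū (arity of S) followed by x̄ (arity of R).
UpdateProgram : Schema → Schema → Set
UpdateProgram τin τaux =
  (R : Fin (size τaux)) (k : Kind) (S : Fin (size τin)) →
  Formula (τin ∪ₛ τaux) (arity τin S + arity τaux R)

IsCQnegProgram : ∀ {τin τaux} → UpdateProgram τin τaux → Set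
IsCQnegProgram P = ∀ R k S → IsCQneg (P R k S)

record State (τin τaux : Schema) (n : ℕ) : Set where
  constructor state
  field
    inp : Database τin n
    aux : Database τaux n
open State public

combine : ∀ {τin τaux n} → Database τin n → Database τaux n → Struct (τin ∪ₛ τaux) n
combine I A (inj₁ R) = I R
combine I A (inj₂ R) = A R

step : ∀ {τin τaux n} → UpdateProgram τin τaux → Modification τin n →
       State τin τaux n → State τin τaux n
step P δ@(mod k S a) (state I A) =
  state (applyMod δ I) (λ R b → ⟦ P R k S ⟧ (combine I A) (a ++ b))

run : ∀ {τin τaux n} → UpdateProgram τin τaux → List (Modification τin n) →
      State τin τaux n → State τin τaux n
run P α 𝒮 = foldl (λ s δ → step P δ s) 𝒮 α

record DynProgram (τin τaux : Schema) : Set where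
  field
    program : UpdateProgram τin τaux
    Init    : ∀ {n} → Database τin n → Database τaux n
    Q       : Fin (size τaux)

Maintains : ∀ {τin τaux k} → DynProgram τin τaux → Query τin k → Set
Maintains {τin} {τaux} {k} 𝔓 𝒬 =
  Σ (arity τaux (DynProgram.Q 𝔓) ≡ k) λ e →
    ∀ {n} (D : Database τin n) (α : List (Modification τin n)) (b : Tuple n k) →
      𝒬 (applyMods α D) b ≡
      aux (run (DynProgram.program 𝔓) α (state D (DynProgram.Init 𝔓 D)))
          (DynProgram.Q 𝔓) (subst (Tuple n) (Relation.Binary.PropositionalEquality.sym e) b)

InDynCQneg : ∀ {τin k} → Query τin k → Set₀
InDynCQneg {τin} 𝒬 =
  Σ Schema λ τaux → Σ (DynProgram τin τaux) λ 𝔓 →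
    IsCQnegProgram (DynProgram.program 𝔓) × Maintains 𝔓 𝒬

module Submission where

-- For every occurrence of a subformula ψ at depth d of the query formula (written
-- with ¬, ∧, ∃ only) and every sequence ρ of d modification shapes, an auxiliary
-- relation holds the tuples (u, x̄) such that the current database, further modified
-- by ρ(u), satisfies ψ(x̄).  After a modification δ(a) the relation for (ψ, ρ) at
-- (u, x̄) is the old relation for (ψ, δρ) at (a, u, x̄), and for compound ψ that is
-- obtained from the old relations of the immediate subformulas of ψ by ¬, ∧ or ∃
-- alone; patterns grow only along the formula tree, so finitely many relations
-- suffice.  For an atom the new value is a disjunction: δρ sets the fact, or the fact
-- held and δρ leaves it untouched.  Remembering the last modification splits "held"
-- into "held and untouched by the last modification" and "set by it", and each of
-- these, like the static relations recording what patterns do, is updated by a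
-- conjunction of literals.

open import Defs
open import Data.Nat using (ℕ; zero; suc; _+_)
open import Data.Fin using (Fin; zero; suc; _≟_)
open import Data.Vec as V using (Vec; []; _∷_; lookup; _++_; map; take; drop)
open import Data.Vec.Properties
  using (map-++; map-∘; map-cong; lookup-map; map-lookup-allFin; take-map; drop-map; take++drop≡id)
open import Data.Bool using (Bool; true; false; _∧_; _∨_; not; if_then_else_)
open import Data.Bool.Properties using (∨-zeroʳ; ∨-identityʳ; ∧-zeroʳ; ∧-identityʳ; not-involutive)
open import Data.Maybe using (Maybe; just; nothing; fromMaybe; is-nothing; _<∣>_)
open import Data.Sum using (inj₁; inj₂)
open import Data.Product using (Σ; _×_; _,_; proj₁; proj₂)
open import Data.List as L using (List; []; _∷_; concatMap; length)
open import Data.List.Relation.Unary.Any as Any using (here; there)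
open import Data.List.Relation.Unary.Any.Properties using (lookup-index)
open import Data.List.Membership.Propositional using (_∈_)
open import Data.List.Membership.Propositional.Properties
  using (∈-map⁺; ∈-concatMap⁺; ∈-allFin; ∈-cartesianProduct⁺)
open import Data.List.Relation.Binary.Subset.Propositional using (_⊆_)
open import Data.List.Relation.Binary.Subset.Propositional.Properties using (xs⊆xs++ys; xs⊆ys++xs)
open import Function using (_∘′_)
open import Relation.Nullary using (yes; no)
open import Relation.Nullary.Decidable using (⌊_⌋)
open import Relation.Binary.PropositionalEquality using (_≡_; refl; sym; trans; cong; cong₂; subst)
open Relation.Binary.PropositionalEquality.≡-Reasoning

take-++ : ∀ {A : Set} {m k} (xs : Vec A m) (ys : Vec A k) → take m (xs ++ ys) ≡ xs
take-++ []       ys = refl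
take-++ (x ∷ xs) ys = cong (x ∷_) (take-++ xs ys)

drop-++ : ∀ {A : Set} {m k} (xs : Vec A m) (ys : Vec A k) → drop m (xs ++ ys) ≡ ys
drop-++ []       ys = refl
drop-++ (x ∷ xs) ys = drop-++ xs ys

∈-concatMap⁺′ : ∀ {A B : Set} (f : A → List B) {x xs y} → x ∈ xs → y ∈ f x → y ∈ concatMap f xs
∈-concatMap⁺′ f x∈xs y∈fx = ∈-concatMap⁺ f (Any.map (λ { refl → y∈fx }) x∈xs)

vecsOver : ∀ {A : Set} → List A → (m : ℕ) → List (Vec A m)
vecsOver xs zero    = [] ∷ []
vecsOver xs (suc m) = concatMap (λ x → L.map (x ∷_) (vecsOver xs m)) xs

∈-vecsOver : ∀ {A : Set} {xs : List A} → (∀ x → x ∈ xs) → ∀ {m} (ys : Vec A m) → ys ∈ vecsOver xs m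
∈-vecsOver all∈ []       = here refl
∈-vecsOver all∈ (y ∷ ys) = ∈-concatMap⁺′ _ (all∈ y) (∈-map⁺ (y ∷_) (∈-vecsOver all∈ ys))

anyFin-cong : ∀ {n} {f g : Fin n → Bool} → (∀ i → f i ≡ g i) → anyFin f ≡ anyFin g
anyFin-cong {zero}  f≗g = refl
anyFin-cong {suc n} f≗g = cong₂ _∨_ (f≗g zero) (anyFin-cong (λ i → f≗g (suc i)))

allFin≡not-anyFin-not : ∀ {n} (f : Fin n → Bool) → allFin f ≡ not (anyFin (λ i → not (f i)))
allFin≡not-anyFin-not {zero}  f = refl
allFin≡not-anyFin-not {suc n} f with f zero
... | true  = allFin≡not-anyFin-not (λ i → f (suc i))
... | false = refl

not-∧-not : ∀ x y → not (not x ∧ not y) ≡ x ∨ y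
not-∧-not true  y     = refl
not-∧-not false true  = refl
not-∧-not false false = refl

fromMaybe-<∣> : ∀ {A : Set} (x : A) m₁ m₂ → fromMaybe (fromMaybe x m₂) m₁ ≡ fromMaybe x (m₁ <∣> m₂)
fromMaybe-<∣> x (just y) m₂ = refl
fromMaybe-<∣> x nothing  m₂ = refl

∧-is-nothing-<∣> : ∀ x (m₁ m₂ : Maybe Bool) →
                   x ∧ is-nothing (m₁ <∣> m₂) ≡ fromMaybe x m₂ ∧ (is-nothing m₂ ∧ is-nothing m₁)
∧-is-nothing-<∣> x (just y) nothing  = refl
∧-is-nothing-<∣> x nothing  nothing  = refl
∧-is-nothing-<∣> x (just _) (just y) = trans (∧-zeroʳ x) (sym (∧-zeroʳ y))
∧-is-nothing-<∣> x nothing  (just y) = trans (∧-zeroʳ x) (sym (∧-zeroʳ y))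

not-fromMaybe : ∀ {x : Bool} (e m : Maybe Bool) → (∀ b → e ≡ just b → x ≡ b) →
                not (fromMaybe x m) ≡
                  not (fromMaybe false m) ∧ (not (x ∧ (is-nothing e ∧ is-nothing m))
                                            ∧ not (fromMaybe false e ∧ is-nothing m))
not-fromMaybe {x} e (just true)  x≡e = refl
not-fromMaybe {x} e (just false) x≡e
  rewrite ∧-zeroʳ (is-nothing e) | ∧-zeroʳ x | ∧-zeroʳ (fromMaybe false e) = refl
not-fromMaybe {true}  nothing  nothing x≡e = refl
not-fromMaybe {false} nothing  nothing x≡e = refl
not-fromMaybe         (just b) nothing x≡e with x≡e b refl
... | refl with b
...   | true  = refl
...   | false = refl

data Basic (σ : Sig) : ℕ → Set where
  atomᵇ : ∀ {v} (R : Sym σ) → Vec (Fin v) (ar σ R) → Basic σ v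
  eqᵇ   : ∀ {v} → Fin v → Fin v → Basic σ v
  ¬ᵇ_   : ∀ {v} → Basic σ v → Basic σ v
  _∧ᵇ_  : ∀ {v} → Basic σ v → Basic σ v → Basic σ v
  ∃ᵇ_   : ∀ {v} → Basic σ (suc v) → Basic σ v

⟦_⟧ᵇ : ∀ {σ n v} → Basic σ v → Struct σ n → Tuple n v → Bool
⟦ atomᵇ R xs ⟧ᵇ 𝔄 ρ = 𝔄 R (map (lookup ρ) xs)
⟦ eqᵇ x y    ⟧ᵇ 𝔄 ρ = ⌊ lookup ρ x ≟ lookup ρ y ⌋
⟦ ¬ᵇ φ       ⟧ᵇ 𝔄 ρ = not (⟦ φ ⟧ᵇ 𝔄 ρ)
⟦ φ ∧ᵇ ψ     ⟧ᵇ 𝔄 ρ = ⟦ φ ⟧ᵇ 𝔄 ρ ∧ ⟦ ψ ⟧ᵇ 𝔄 ρ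
⟦ ∃ᵇ φ       ⟧ᵇ 𝔄 ρ = anyFin (λ d → ⟦ φ ⟧ᵇ 𝔄 (d ∷ ρ))

toBasic : ∀ {σ v} → Formula σ v → Basic σ v
toBasic (atom R xs) = atomᵇ R xs
toBasic (eq x y)    = eqᵇ x y
toBasic (¬' φ)      = ¬ᵇ toBasic φ
toBasic (φ ∧' ψ)    = toBasic φ ∧ᵇ toBasic ψ
toBasic (φ ∨' ψ)    = ¬ᵇ ((¬ᵇ toBasic φ) ∧ᵇ (¬ᵇ toBasic ψ))
toBasic (∃' φ)      = ∃ᵇ toBasic φ
toBasic (∀' φ)      = ¬ᵇ ∃ᵇ ¬ᵇ toBasic φ

toBasic-sound : ∀ {σ n v} (φ : Formula σ v) (𝔄 : Struct σ n) ρ → ⟦ toBasic φ ⟧ᵇ 𝔄 ρ ≡ ⟦ φ ⟧ 𝔄 ρ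
toBasic-sound (atom R xs) 𝔄 ρ = refl
toBasic-sound (eq x y)    𝔄 ρ = refl
toBasic-sound (¬' φ)      𝔄 ρ = cong not (toBasic-sound φ 𝔄 ρ)
toBasic-sound (φ ∧' ψ)    𝔄 ρ = cong₂ _∧_ (toBasic-sound φ 𝔄 ρ) (toBasic-sound ψ 𝔄 ρ)
toBasic-sound (φ ∨' ψ)    𝔄 ρ =
  trans (not-∧-not (⟦ toBasic φ ⟧ᵇ 𝔄 ρ) (⟦ toBasic ψ ⟧ᵇ 𝔄 ρ))
        (cong₂ _∨_ (toBasic-sound φ 𝔄 ρ) (toBasic-sound ψ 𝔄 ρ))
toBasic-sound (∃' φ)      𝔄 ρ = anyFin-cong (λ d → toBasic-sound φ 𝔄 (d ∷ ρ))
toBasic-sound (∀' φ)      𝔄 ρ =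
  trans (cong not (anyFin-cong (λ d → cong not (toBasic-sound φ 𝔄 (d ∷ ρ)))))
        (sym (allFin≡not-anyFin-not (λ d → ⟦ φ ⟧ 𝔄 (d ∷ ρ))))

-- A pattern ρ is a vector of modification shapes; the tuples of its modifications
-- are supplied together as one parameter vector u of length patternAr ρ.
module Patterns (τ : Schema) where

  Shape : Set
  Shape = Kind × Fin (size τ)

  allShapes : List Shape
  allShapes = L.cartesianProduct (ins ∷ del ∷ []) (L.allFin (size τ))

  ∈-allShapes : ∀ t → t ∈ allShapes
  ∈-allShapes (ins , S) = ∈-cartesianProduct⁺ {xs = ins ∷ del ∷ []} (here refl) (∈-allFin S)
  ∈-allShapes (del , S) = ∈-cartesianProduct⁺ {xs = ins ∷ del ∷ []} (there (here refl)) (∈-allFin S)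

  shapeAr : Shape → ℕ
  shapeAr t = arity τ (proj₂ t)

  patternAr : ∀ {m} → Vec Shape m → ℕ
  patternAr []      = 0
  patternAr (t ∷ ρ) = shapeAr t + patternAr ρ

  isInsert : Kind → Bool
  isInsert ins = true
  isInsert del = false

  effect : ∀ {n} (t : Shape) → Tuple n (shapeAr t) → (S : Fin (size τ)) → Tuple n (arity τ S) → Maybe Bool
  effect (κ , S′) a S z with S′ ≟ S
  ... | yes refl = if z ≟ₜ a then just (isInsert κ) else nothing
  ... | no  _    = nothing

  applyMod-effect : ∀ {n} κ S′ (a : Tuple n (arity τ S′)) (J : Database τ n) S z →
                    applyMod (mod κ S′ a) J S z ≡ fromMaybe (J S z) (effect (κ , S′) a S z)
  applyMod-effect κ S′ a J S z with S′ ≟ S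
  applyMod-effect ins S′ a J .S′ z | yes refl with z ≟ₜ a
  ... | true  = ∨-zeroʳ _
  ... | false = ∨-identityʳ _
  applyMod-effect del S′ a J .S′ z | yes refl with z ≟ₜ a
  ... | true  = ∧-zeroʳ _
  ... | false = ∧-identityʳ _
  applyMod-effect κ S′ a J S z | no _ = refl

  patch : ∀ {n m} (ρ : Vec Shape m) → Tuple n (patternAr ρ) → Database τ n → Database τ n
  patch []      u J = J
  patch (t ∷ ρ) u J = patch ρ (drop (shapeAr t) u) (applyMod (mod (proj₁ t) (proj₂ t) (take (shapeAr t) u)) J)

  look : ∀ {n m} (ρ : Vec Shape m) → Tuple n (patternAr ρ) → (S : Fin (size τ)) → Tuple n (arity τ S) → Maybe Bool
  look []      u S z = nothing
  look (t ∷ ρ) u S z = look ρ (drop (shapeAr t) u) S z <∣> effect t (take (shapeAr t) u) S z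

  patch-look : ∀ {n m} (ρ : Vec Shape m) u (J : Database τ n) S z →
               patch ρ u J S z ≡ fromMaybe (J S z) (look ρ u S z)
  patch-look []            u J S z = refl
  patch-look ((κ , S′) ∷ ρ) u J S z = begin
    patch ρ u′ (applyMod (mod κ S′ a) J) S z
      ≡⟨ patch-look ρ u′ _ S z ⟩
    fromMaybe (applyMod (mod κ S′ a) J S z) (look ρ u′ S z)
      ≡⟨ cong (λ x → fromMaybe x (look ρ u′ S z)) (applyMod-effect κ S′ a J S z) ⟩
    fromMaybe (fromMaybe (J S z) (effect (κ , S′) a S z)) (look ρ u′ S z)
      ≡⟨ fromMaybe-<∣> (J S z) (look ρ u′ S z) _ ⟩
    fromMaybe (J S z) (look ((κ , S′) ∷ ρ) u S z) ∎
    where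
    a  = take (arity τ S′) u
    u′ = drop (arity τ S′) u

  patch-∷ : ∀ {n m} κ S (ρ : Vec Shape m) (a : Tuple n (arity τ S)) u (J : Database τ n) →
            patch ((κ , S) ∷ ρ) (a ++ u) J ≡ patch ρ u (applyMod (mod κ S a) J)
  patch-∷ κ S ρ a u J rewrite take-++ a u | drop-++ a u = refl

  look-∷ : ∀ {n m} t (ρ : Vec Shape m) (a : Tuple n (shapeAr t)) u S z →
           look (t ∷ ρ) (a ++ u) S z ≡ look ρ u S z <∣> effect t a S z
  look-∷ t ρ a u S z rewrite take-++ a u | drop-++ a u = refl

  Last : ℕ → Set
  Last n = Maybe (Σ Shape λ t → Tuple n (shapeAr t))

  lastEffect : ∀ {n} → Last n → (S : Fin (size τ)) → Tuple n (arity τ S) → Maybe Bool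
  lastEffect nothing        S z = nothing
  lastEffect (just (t , a)) S z = effect t a S z

  Consistent : ∀ {n} → Database τ n → Last n → Set
  Consistent I ℓ = ∀ S z b → lastEffect ℓ S z ≡ just b → I S z ≡ b

  applyMod-consistent : ∀ {n} κ S (a : Tuple n (arity τ S)) (I : Database τ n) →
                        Consistent (applyMod (mod κ S a) I) (just ((κ , S) , a))
  applyMod-consistent κ S a I S′ z b e = trans (applyMod-effect κ S a I S′ z) (cong (fromMaybe (I S′ z)) e)

module Construction (τin : Schema) {k : ℕ} (φ : Basic (sigOf τin) k) where
  open Patterns τin

  B : ℕ → Set
  B = Basic (sigOf τin)

  data Occ : ∀ {v} → B v → ℕ → Set where
    root    : Occ φ 0
    under¬  : ∀ {v d} {χ : B v}         → Occ (¬ᵇ χ) d    → Occ χ (suc d)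
    under∧ˡ : ∀ {v d} {χ χ′ : B v}      → Occ (χ ∧ᵇ χ′) d → Occ χ (suc d)
    under∧ʳ : ∀ {v d} {χ χ′ : B v}      → Occ (χ ∧ᵇ χ′) d → Occ χ′ (suc d)
    under∃  : ∀ {v d} {χ : B (suc v)}   → Occ (∃ᵇ χ) d    → Occ χ (suc d)

  Occurrence : Set
  Occurrence = Σ ℕ λ v → Σ (B v) λ ψ → Σ ℕ (Occ ψ)

  ⌜_⌝ : ∀ {v d} {ψ : B v} → Occ ψ d → Occurrence
  ⌜ o ⌝ = _ , _ , _ , o

  occurrencesBelow : ∀ {v d} (ψ : B v) → Occ ψ d → List Occurrence
  childOccurrences : ∀ {v d} (ψ : B v) → Occ ψ d → List Occurrence
  occurrencesBelow ψ o = ⌜ o ⌝ ∷ childOccurrences ψ o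
  childOccurrences (atomᵇ S xs) o = []
  childOccurrences (eqᵇ x y)    o = []
  childOccurrences (¬ᵇ χ)       o = occurrencesBelow χ (under¬ o)
  childOccurrences (χ ∧ᵇ χ′)    o = occurrencesBelow χ (under∧ˡ o) L.++ occurrencesBelow χ′ (under∧ʳ o)
  childOccurrences (∃ᵇ χ)       o = occurrencesBelow χ (under∃ o)

  occurrencesBelow-⊆ : ∀ {v d} {ψ : B v} (o : Occ ψ d) → occurrencesBelow ψ o ⊆ occurrencesBelow φ root
  occurrencesBelow-⊆ root          = λ p → p
  occurrencesBelow-⊆ (under¬ o)    = λ p → occurrencesBelow-⊆ o (there p)
  occurrencesBelow-⊆ (under∧ˡ o)   = λ p → occurrencesBelow-⊆ o (there (xs⊆xs++ys _ _ p))
  occurrencesBelow-⊆ (under∧ʳ {χ = χ} o) =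
    λ p → occurrencesBelow-⊆ o (there (xs⊆ys++xs _ (occurrencesBelow χ (under∧ˡ o)) p))
  occurrencesBelow-⊆ (under∃ o)    = λ p → occurrencesBelow-⊆ o (there p)

  ∈-occurrences : ∀ {v d} {ψ : B v} (o : Occ ψ d) → ⌜ o ⌝ ∈ occurrencesBelow φ root
  ∈-occurrences o = occurrencesBelow-⊆ o (here refl)

  data Role : ∀ {v} → B v → Set where
    value : ∀ {v} {ψ : B v} → Role ψ
    absent setInPattern keptPresent setByLast untouched :
      ∀ {v S} {xs : Vec (Fin v) (arity τin S)} → Role (atomᵇ S xs)
    setBy : ∀ {v S} {xs : Vec (Fin v) (arity τin S)} → Shape → Role (atomᵇ S xs)

  -- The update formula of a node refers to nodes whose pattern has the current
  -- modification prepended; depth r is the pattern length needed by role r.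
  depth : ∀ {v} {ψ : B v} → Role ψ → ℕ
  depth value        = 0
  depth absent       = 1
  depth setInPattern = 2
  depth keptPresent  = 2
  depth setByLast    = 2
  depth (setBy _)    = 2
  depth untouched    = 3

  atomRoles : ∀ {v} (ψ : B v) → List (Role ψ)
  atomRoles (atomᵇ S xs) = absent ∷ setInPattern ∷ keptPresent ∷ setByLast ∷ untouched ∷ L.map setBy allShapes
  atomRoles _            = []

  roles : ∀ {v} (ψ : B v) → List (Role ψ)
  roles ψ = value ∷ atomRoles ψ

  ∈-roles : ∀ {v} {ψ : B v} (r : Role ψ) → r ∈ roles ψ
  ∈-roles value        = here refl
  ∈-roles absent       = there (here refl)
  ∈-roles setInPattern = there (there (here refl))
  ∈-roles keptPresent  = there (there (there (here refl)))
  ∈-roles setByLast    = there (there (there (there (here refl))))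
  ∈-roles untouched    = there (there (there (there (there (here refl)))))
  ∈-roles (setBy t)    = there (there (there (there (there (there (∈-map⁺ setBy (∈-allShapes t)))))))

  data Node : Set where
    node : ∀ {v d} {ψ : B v} → Occ ψ d → (r : Role ψ) → Vec Shape (depth r + d) → Node

  nodesWith : ∀ {v d} {ψ : B v} → Occ ψ d → Role ψ → List Node
  nodesWith {d = d} o r = L.map (node o r) (vecsOver allShapes (depth r + d))

  nodesAt : Occurrence → List Node
  nodesAt (_ , ψ , _ , o) = concatMap (nodesWith o) (roles ψ)

  rootNode : Node
  rootNode = node root value []

  allNodes : List Node
  allNodes = rootNode ∷ concatMap nodesAt (occurrencesBelow φ root)

  ∈-allNodes : ∀ Y → Y ∈ allNodes
  ∈-allNodes (node o r ρ) =
    there (∈-concatMap⁺′ nodesAt (∈-occurrences o)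
            (∈-concatMap⁺′ (nodesWith o) (∈-roles r) (∈-map⁺ (node o r) (∈-vecsOver ∈-allShapes ρ))))

  paramAr : Node → ℕ
  paramAr (node _ (setBy t) ρ) = patternAr (t ∷ ρ)
  paramAr (node _ _         ρ) = patternAr ρ

  tailAr : Node → ℕ
  tailAr (node {v} _ value _)            = v
  tailAr (node {ψ = atomᵇ S _} _ _ _)    = arity τin S

  nodeAr : Node → ℕ
  nodeAr Y = paramAr Y + tailAr Y

  mean : (Y : Node) → ∀ {n} → Database τin n → Last n → Tuple n (paramAr Y) → Tuple n (tailAr Y) → Bool
  mean (node {ψ = ψ} _ value ρ)             I ℓ u z = ⟦ ψ ⟧ᵇ (patch ρ u I) z
  mean (node _ (absent {S = S}) ρ)          I ℓ u z = not (patch ρ u I S z)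
  mean (node _ (setInPattern {S = S}) ρ)    I ℓ u z = fromMaybe false (look ρ u S z)
  mean (node _ (keptPresent {S = S}) ρ)     I ℓ u z =
    I S z ∧ (is-nothing (lastEffect ℓ S z) ∧ is-nothing (look ρ u S z))
  mean (node _ (setByLast {S = S}) ρ)       I ℓ u z = fromMaybe false (lastEffect ℓ S z) ∧ is-nothing (look ρ u S z)
  mean (node _ (setBy {S = S} t) ρ)         I ℓ u z =
    fromMaybe false (effect t (take (shapeAr t) u) S z) ∧ is-nothing (look ρ (drop (shapeAr t) u) S z)
  mean (node _ (untouched {S = S}) ρ)       I ℓ u z = is-nothing (look ρ u S z)

  meaning : (Y : Node) → ∀ {n} → Database τin n → Last n → Rel n (nodeAr Y)
  meaning Y I ℓ b = mean Y I ℓ (take (paramAr Y) b) (drop (paramAr Y) b)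

  meaning-++ : (Y : Node) → ∀ {n} (I : Database τin n) ℓ u z → meaning Y I ℓ (u ++ z) ≡ mean Y I ℓ u z
  meaning-++ Y I ℓ u z = cong₂ (mean Y I ℓ) (take-++ u z) (drop-++ u z)

  τaux : Schema
  τaux = record { size = length allNodes ; arity = λ i → nodeAr (L.lookup allNodes i) }

  σ : Sig
  σ = τin ∪ₛ τaux

  index : Node → Fin (length allNodes)
  index Y = Any.index (∈-allNodes Y)

  index-lookup : ∀ Y → Y ≡ L.lookup allNodes (index Y)
  index-lookup Y = lookup-index (∈-allNodes Y)

  auxAtom : ∀ {v} (Y : Node) → Vec (Fin v) (nodeAr Y) → Formula σ v
  auxAtom Y xs = atom (inj₂ (index Y)) (subst (Vec (Fin _)) (cong nodeAr (index-lookup Y)) xs)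

  Conj CQ : ℕ → Set
  Conj v = Σ (Formula σ v) IsConjLit
  CQ   v = Σ (Formula σ v) IsCQneg

  aux⁺ aux⁻ : ∀ {v} (Y : Node) → Vec (Fin v) (nodeAr Y) → Conj v
  aux⁺ Y xs = auxAtom Y xs , lit (pos (atomR _ _))
  aux⁻ Y xs = ¬' (auxAtom Y xs) , lit (neg (atomR _ _))

  inp⁺ : ∀ {v} (S : Fin (size τin)) → Vec (Fin v) (arity τin S) → Conj v
  inp⁺ S xs = atom (inj₁ S) xs , lit (pos (atomR _ _))

  _∧ᶜ_ : ∀ {v} → Conj v → Conj v → Conj v
  (α , p) ∧ᶜ (β , q) = α ∧' β , conj p q

  [_] : ∀ {v} → Conj v → CQ v
  [ α , p ] = α , body p

  ∃ᶜ : ∀ {v} → CQ (suc v) → CQ v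
  ∃ᶜ (α , p) = ∃' α , ex p

  -- Variables of an update formula for node Y: the modified tuple, then the
  -- parameters and the tail of Y.
  module Vars (s : ℕ) (Y : Node) where
    vars : Vec (Fin (s + nodeAr Y)) (s + nodeAr Y)
    vars = V.allFin _

    modVars   = take s vars
    rest      = drop s vars
    paramVars = take (paramAr Y) rest
    tailVars  = drop (paramAr Y) rest
    prefix    = modVars ++ paramVars
    shifted   = prefix ++ tailVars

  module Update (κ : Kind) (S₀ : Fin (size τin)) where
    open Vars (arity τin S₀)

    δ : Shape
    δ = κ , S₀

    update : (Y : Node) → CQ (arity τin S₀ + nodeAr Y)
    update Y@(node {ψ = atomᵇ S xs} o value ρ) =
      [ aux⁻ (node o absent (δ ∷ ρ)) (prefix Y ++ map (lookup (tailVars Y)) xs) ]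
    update Y@(node {ψ = eqᵇ _ _} _ value _) = [ aux⁺ Y (rest Y) ]
    update Y@(node {ψ = ¬ᵇ _} o value ρ) = [ aux⁻ (node (under¬ o) value (δ ∷ ρ)) (shifted Y) ]
    update Y@(node {ψ = _ ∧ᵇ _} o value ρ) =
      [ aux⁺ (node (under∧ˡ o) value (δ ∷ ρ)) (shifted Y) ∧ᶜ aux⁺ (node (under∧ʳ o) value (δ ∷ ρ)) (shifted Y) ]
    update Y@(node {ψ = ∃ᵇ _} o value ρ) =
      ∃ᶜ [ aux⁺ (node (under∃ o) value (δ ∷ ρ)) (map suc (prefix Y) ++ (zero ∷ map suc (tailVars Y))) ]
    update Y@(node o absent ρ) =
      [ aux⁻ (node o setInPattern (δ ∷ ρ)) (shifted Y)
        ∧ᶜ (aux⁻ (node o keptPresent (δ ∷ ρ)) (shifted Y) ∧ᶜ aux⁻ (node o setByLast (δ ∷ ρ)) (shifted Y)) ]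
    update Y@(node _ setInPattern _) = [ aux⁺ Y (rest Y) ]
    update Y@(node o (keptPresent {S = S}) ρ) =
      [ inp⁺ S (tailVars Y) ∧ᶜ aux⁺ (node o untouched (δ ∷ ρ)) (shifted Y) ]
    update Y@(node o setByLast ρ) = [ aux⁺ (node o (setBy δ) ρ) (shifted Y) ]
    update Y@(node _ (setBy _) _) = [ aux⁺ Y (rest Y) ]
    update Y@(node _ untouched _) = [ aux⁺ Y (rest Y) ]

  module VarsSound (s : ℕ) (Y : Node) {n} (a : Tuple n s) (u : Tuple n (paramAr Y)) (z : Tuple n (tailAr Y)) where
    open Vars s Y public

    env : Tuple n (s + nodeAr Y)
    env = a ++ (u ++ z)

    rest↦ : map (lookup env) rest ≡ u ++ z
    rest↦ = trans (sym (drop-map (lookup env) s vars))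
                  (trans (cong (drop s) (map-lookup-allFin env)) (drop-++ a (u ++ z)))

    modVars↦ : map (lookup env) modVars ≡ a
    modVars↦ = trans (sym (take-map (lookup env) s vars))
                     (trans (cong (take s) (map-lookup-allFin env)) (take-++ a (u ++ z)))

    tailVars↦ : map (lookup env) tailVars ≡ z
    tailVars↦ = trans (sym (drop-map (lookup env) (paramAr Y) rest)) (trans (cong (drop _) rest↦) (drop-++ u z))

    prefix↦ : map (lookup env) prefix ≡ a ++ u
    prefix↦ = trans (map-++ (lookup env) modVars paramVars)
                    (cong₂ _++_ modVars↦ (trans (sym (take-map (lookup env) (paramAr Y) rest))
                                                (trans (cong (take _) rest↦) (take-++ u z))))

    shifted↦ : map (lookup env) shifted ≡ (a ++ u) ++ z
    shifted↦ = trans (map-++ (lookup env) prefix tailVars) (cong₂ _++_ prefix↦ tailVars↦)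

    suc↦ : ∀ {m} (d : Fin n) (xs : Vec (Fin (s + nodeAr Y)) m) → map (lookup (d ∷ env)) (map suc xs) ≡ map (lookup env) xs
    suc↦ d xs = sym (map-∘ (lookup (d ∷ env)) suc xs)

  Invariant : ∀ {n} → Database τin n → Last n → Database τaux n → Set
  Invariant I ℓ A = Consistent I ℓ × (∀ i b → A i b ≡ meaning (L.lookup allNodes i) I ℓ b)

  module _ {n} {I : Database τin n} {ℓ : Last n} {A : Database τaux n} (inv : Invariant I ℓ A) where

    auxAtom-sound : ∀ {v} (Y : Node) (xs : Vec (Fin v) (nodeAr Y)) (env : Tuple n v) {u z} →
                    map (lookup env) xs ≡ u ++ z → ⟦ auxAtom Y xs ⟧ (combine I A) env ≡ mean Y I ℓ u z
    auxAtom-sound Y xs env {u} {z} xs↦ =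
      trans (proj₂ inv (index Y) _)
            (trans (meaning-subst (index-lookup Y))
                   (trans (cong (meaning Y I ℓ) xs↦) (meaning-++ Y I ℓ u z)))
      where
      meaning-subst : ∀ {Z} (e : Y ≡ Z) →
                      meaning Z I ℓ (map (lookup env) (subst (Vec (Fin _)) (cong nodeAr e) xs)) ≡
                      meaning Y I ℓ (map (lookup env) xs)
      meaning-subst refl = refl

  module UpdateSound {n} {I : Database τin n} {ℓ : Last n} {A : Database τaux n} (inv : Invariant I ℓ A)
                     (κ : Kind) (S₀ : Fin (size τin)) (a : Tuple n (arity τin S₀)) where
    open Update κ S₀ using (update; δ)

    I′ : Database τin n
    I′ = applyMod (mod κ S₀ a) I

    ℓ′ : Last n
    ℓ′ = just (δ , a)

    value-child : ∀ {v d} {χ : B v} (o : Occ χ (suc d)) (ρ : Vec Shape d) {w} (xs : Vec (Fin w) _) env u z →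
                  map (lookup env) xs ≡ (a ++ u) ++ z →
                  ⟦ auxAtom (node o value (δ ∷ ρ)) xs ⟧ (combine I A) env ≡ ⟦ χ ⟧ᵇ (patch ρ u I′) z
    value-child {χ = χ} o ρ xs env u z xs↦ =
      trans (auxAtom-sound inv (node o value (δ ∷ ρ)) xs env xs↦) (cong (λ J → ⟦ χ ⟧ᵇ J z) (patch-∷ κ S₀ ρ a u I))

    absent-step : ∀ {v d S} {xs : Vec (Fin v) (arity τin S)} (o : Occ (atomᵇ S xs) d) (ρ : Vec Shape (suc d)) u z →
                  not (mean (node o setInPattern (δ ∷ ρ)) I ℓ (a ++ u) z)
                    ∧ (not (mean (node o keptPresent (δ ∷ ρ)) I ℓ (a ++ u) z)
                       ∧ not (mean (node o setByLast (δ ∷ ρ)) I ℓ (a ++ u) z))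
                  ≡ not (patch ρ u I′ S z)
    absent-step {S = S} o ρ u z = begin
      not (fromMaybe false m) ∧ (not (I S z ∧ (is-nothing e ∧ is-nothing m)) ∧ not (fromMaybe false e ∧ is-nothing m))
        ≡⟨ not-fromMaybe e m (proj₁ inv S z) ⟨
      not (fromMaybe (I S z) m)                 ≡⟨ cong not (patch-look (δ ∷ ρ) (a ++ u) I S z) ⟨
      not (patch (δ ∷ ρ) (a ++ u) I S z)        ≡⟨ cong (λ J → not (J S z)) (patch-∷ κ S₀ ρ a u I) ⟩
      not (patch ρ u I′ S z)                    ∎
      where
      e = lastEffect ℓ S z
      m = look (δ ∷ ρ) (a ++ u) S z

    keptPresent-step : ∀ {v d S} {xs : Vec (Fin v) (arity τin S)} (o : Occ (atomᵇ S xs) d) (ρ : Vec Shape (2 + d)) u z →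
                       I S z ∧ mean (node o untouched (δ ∷ ρ)) I ℓ (a ++ u) z ≡ mean (node o keptPresent ρ) I′ ℓ′ u z
    keptPresent-step {S = S} o ρ u z = begin
      I S z ∧ is-nothing (look (δ ∷ ρ) (a ++ u) S z)
        ≡⟨ cong (λ m → I S z ∧ is-nothing m) (look-∷ δ ρ a u S z) ⟩
      I S z ∧ is-nothing (look ρ u S z <∣> e)
        ≡⟨ ∧-is-nothing-<∣> (I S z) (look ρ u S z) e ⟩
      fromMaybe (I S z) e ∧ (is-nothing e ∧ is-nothing (look ρ u S z))
        ≡⟨ cong (_∧ _) (applyMod-effect κ S₀ a I S z) ⟨
      I′ S z ∧ (is-nothing e ∧ is-nothing (look ρ u S z)) ∎
      where e = effect δ a S z

    update-sound : (Y : Node) (u : Tuple n (paramAr Y)) (z : Tuple n (tailAr Y)) →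
                   ⟦ proj₁ (update Y) ⟧ (combine I A) (a ++ (u ++ z)) ≡ mean Y I′ ℓ′ u z
    update-sound Y@(node {ψ = atomᵇ S xs} o value ρ) u z =
      trans (cong not (auxAtom-sound inv (node o absent (δ ∷ ρ)) _ env args↦))
            (trans (not-involutive _) (cong (λ J → J S w) (patch-∷ κ S₀ ρ a u I)))
      where
      open VarsSound (arity τin S₀) Y a u z
      w = map (lookup z) xs
      atomArgs↦ : map (lookup env) (map (lookup tailVars) xs) ≡ w
      atomArgs↦ = begin
        map (lookup env) (map (lookup tailVars) xs)   ≡⟨ map-∘ (lookup env) (lookup tailVars) xs ⟨
        map (lookup env ∘′ lookup tailVars) xs        ≡⟨ map-cong (λ i → lookup-map i (lookup env) tailVars) xs ⟨
        map (lookup (map (lookup env) tailVars)) xs   ≡⟨ cong (λ t → map (lookup t) xs) tailVars↦ ⟩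
        w                                             ∎
      args↦ : map (lookup env) (prefix ++ map (lookup tailVars) xs) ≡ (a ++ u) ++ w
      args↦ = trans (map-++ (lookup env) prefix _) (cong₂ _++_ prefix↦ atomArgs↦)
    update-sound Y@(node {ψ = eqᵇ _ _} _ value _) u z = auxAtom-sound inv Y _ env {u} {z} rest↦
      where open VarsSound (arity τin S₀) Y a u z
    update-sound Y@(node {ψ = ¬ᵇ _} o value ρ) u z =
      cong not (value-child (under¬ o) ρ shifted env u z shifted↦)
      where open VarsSound (arity τin S₀) Y a u z
    update-sound Y@(node {ψ = _ ∧ᵇ _} o value ρ) u z =
      cong₂ _∧_ (value-child (under∧ˡ o) ρ shifted env u z shifted↦)
                (value-child (under∧ʳ o) ρ shifted env u z shifted↦)
      where open VarsSound (arity τin S₀) Y a u z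
    update-sound Y@(node {ψ = ∃ᵇ _} o value ρ) u z =
      anyFin-cong (λ d → value-child (under∃ o) ρ _ (d ∷ env) u (d ∷ z) (args↦ d))
      where
      open VarsSound (arity τin S₀) Y a u z
      args↦ : ∀ d → map (lookup (d ∷ env)) (map suc prefix ++ (zero ∷ map suc tailVars)) ≡ (a ++ u) ++ (d ∷ z)
      args↦ d = trans (map-++ (lookup (d ∷ env)) (map suc prefix) _)
                      (cong₂ _++_ (trans (suc↦ d prefix) prefix↦) (cong (d ∷_) (trans (suc↦ d tailVars) tailVars↦)))
    update-sound Y@(node o absent ρ) u z =
      trans (cong₂ _∧_ (cong not (auxAtom-sound inv _ _ env shifted↦))
                       (cong₂ _∧_ (cong not (auxAtom-sound inv _ _ env shifted↦))
                                  (cong not (auxAtom-sound inv _ _ env shifted↦))))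
            (absent-step o ρ u z)
      where open VarsSound (arity τin S₀) Y a u z
    update-sound Y@(node _ setInPattern _) u z = auxAtom-sound inv Y _ env {u} {z} rest↦
      where open VarsSound (arity τin S₀) Y a u z
    update-sound Y@(node o (keptPresent {S = S}) ρ) u z =
      trans (cong₂ _∧_ (cong (I S) tailVars↦) (auxAtom-sound inv _ _ env shifted↦)) (keptPresent-step o ρ u z)
      where open VarsSound (arity τin S₀) Y a u z
    update-sound Y@(node o (setByLast {S = S}) ρ) u z =
      trans (auxAtom-sound inv (node o (setBy δ) ρ) _ env shifted↦)
            (cong₂ (λ a′ u′ → fromMaybe false (effect δ a′ S z) ∧ is-nothing (look ρ u′ S z)) (take-++ a u) (drop-++ a u))
      where open VarsSound (arity τin S₀) Y a u z
    update-sound Y@(node _ (setBy _) _) u z = auxAtom-sound inv Y _ env {u} {z} rest↦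
      where open VarsSound (arity τin S₀) Y a u z
    update-sound Y@(node _ untouched _) u z = auxAtom-sound inv Y _ env {u} {z} rest↦
      where open VarsSound (arity τin S₀) Y a u z

  program : UpdateProgram τin τaux
  program R κ S₀ = proj₁ (Update.update κ S₀ (L.lookup allNodes R))

  program-CQneg : IsCQnegProgram program
  program-CQneg R κ S₀ = proj₂ (Update.update κ S₀ (L.lookup allNodes R))

  step-invariant : ∀ {n} {I : Database τin n} {ℓ A} → Invariant I ℓ A → ∀ κ S₀ a →
                   let 𝒮 = step program (mod κ S₀ a) (state I A) in
                   Invariant (inp 𝒮) (just ((κ , S₀) , a)) (aux 𝒮)
  step-invariant {I = I} {A = A} inv κ S₀ a = applyMod-consistent κ S₀ a I , λ i b →
    let Y = L.lookup allNodes i in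
    trans (cong (λ w → ⟦ program i κ S₀ ⟧ (combine I A) (a ++ w)) (sym (take++drop≡id (paramAr Y) b)))
          (UpdateSound.update-sound inv κ S₀ a Y _ _)

  run-invariant : ∀ {n} (α : List (Modification τin n)) {I ℓ A} → Invariant I ℓ A →
                  Σ (Last n) λ ℓ′ → Invariant (applyMods α I) ℓ′ (aux (run program α (state I A)))
  run-invariant []               {ℓ = ℓ} inv = ℓ , inv
  run-invariant (mod κ S₀ a ∷ α) inv = run-invariant α (step-invariant inv κ S₀ a)

  init : ∀ {n} → Database τin n → Database τaux n
  init D i = meaning (L.lookup allNodes i) D nothing

  init-invariant : ∀ {n} (D : Database τin n) → Invariant D nothing (init D)
  init-invariant D = (λ _ _ _ ()) , (λ _ _ → refl)

  dynProgram : DynProgram τin τaux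
  dynProgram = record { program = program ; Init = init ; Q = zero }

  maintains : (𝒬 : Query τin k) → (∀ {n} (D : Database τin n) b → 𝒬 D b ≡ ⟦ φ ⟧ᵇ D b) →
              Maintains dynProgram 𝒬
  maintains 𝒬 𝒬≡φ = refl , λ D α b →
    let _ , inv = run-invariant α (init-invariant D) in
    trans (𝒬≡φ (applyMods α D) b) (sym (proj₂ inv zero b))

corollary5p2 : (τin : Schema) (k : ℕ) (𝒬 : Query τin k) → FOExpressible 𝒬 → InDynCQneg 𝒬
corollary5p2 τin k 𝒬 (φ , 𝒬≡φ) =
  τaux , dynProgram , program-CQneg , maintains 𝒬 (λ D b → trans (𝒬≡φ D b) (sym (toBasic-sound φ D b)))
  where open Construction τin (toBasic φ)
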